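{- Let $k\ge 4$ and let $T$ be a tree on $n$ vertices containing at least $x$ vertices of degree at least 2. Then the number of (not necessarily induced) subgraphs of $T$ isomorphic to the star $S_k$ is at most $\binom{n-x}{k-1}$.
   Context: $S_k$ denotes the star on $k$ vertices, i.e. one center adjacent to $k-1$ leaves. -}

module Defs where

open import Data.Nat using (ℕ; zero; suc; _≤_; _+_)
open import Data.Fin using (Fin; zero; suc; inject₁; fromℕ; toℕ)
open import Data.Fin.Subset using (Subset; _∈_)
open import Data.Bool using (Bool; true; false)
open import Data.Vec using (Vec; lookup)
open import Data.List using (List; filter; length; allFin)
open import Data.Product using (Σ; _×_; ∃; ∃-syntax)
open import Data.Sum using (_⊎_)
open import Data.Empty using (⊥)
open import Relation.Nullary using (¬_)
open import Relation.Binary.PropositionalEquality using (_≡_; _≢_)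
open import Function.Definitions using (Injective)
open import Function.Bundles using (_⇔_)
import Data.Nat as ℕ

record Graph (n : ℕ) : Set where
  field
    adj   : Fin n → Fin n → Bool
    sym   : ∀ i j → adj i j ≡ adj j i
    irrfl : ∀ i → adj i i ≡ false
open Graph public

data Walk {n : ℕ} (G : Graph n) : Fin n → Fin n → Set where
  here : ∀ {u} → Walk G u u
  step : ∀ {u w v} → adj G u w ≡ true → Walk G w v → Walk G u v

Connected : ∀ {n} → Graph n → Set
Connected G = ∀ u v → Walk G u v

record Cycle {n : ℕ} (G : Graph n) : Set where
  field
    m    : ℕ
    f    : Fin (suc (suc (suc m))) → Fin n
    inj  : Injective _≡_ _≡_ f
    cons : ∀ (i : Fin (suc (suc m))) → adj G (f (inject₁ i)) (f (suc i)) ≡ true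
    wrap : adj G (f (fromℕ (suc (suc m)))) (f zero) ≡ true

Acyclic : ∀ {n} → Graph n → Set
Acyclic G = ¬ Cycle G

IsTree : ∀ {n} → Graph n → Set
IsTree {n} G = (1 ≤ n) × Connected G × Acyclic G

degree : ∀ {n} → Graph n → Fin n → ℕ
degree G v = length (filter (λ w → adj G v w Data.Bool.≟ true) (allFin _))
  where import Data.Bool

numDegGe2 : ∀ {n} → Graph n → ℕ
numDegGe2 G = length (filter (λ v → 2 ℕ.≤? degree G v) (allFin _))

StarAdj : ∀ {k} → Fin k → Fin k → Set
StarAdj a b = (toℕ a ≡ 0 × toℕ b ≢ 0) ⊎ (toℕ a ≢ 0 × toℕ b ≡ 0)

record Subgraph (n : ℕ) : Set where
  constructor sg
  field
    verts : Subset n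
    edges : Vec (Vec Bool n) n
open Subgraph public

E : ∀ {n} → Subgraph n → Fin n → Fin n → Bool
E H i j = lookup (lookup (edges H) i) j

IsSubgraphOf : ∀ {n} → Subgraph n → Graph n → Set
IsSubgraphOf H G = ∀ i j → E H i j ≡ true → (i ∈ verts H) × (j ∈ verts H) × (adj G i j ≡ true)

IsoToStar : ∀ {n} → ℕ → Subgraph n → Set
IsoToStar {n} k H =
  Σ (Fin k → Fin n) λ σ →
    Injective _≡_ _≡_ σ
    × (∀ v → (v ∈ verts H) ⇔ (∃[ a ] σ a ≡ v))
    × (∀ a b → (E H (σ a) (σ b) ≡ true) ⇔ StarAdj a b)

StarCopy : ∀ {n} → Graph n → ℕ → Subgraph n → Set
StarCopy G k H = IsSubgraphOf H G × IsoToStar k H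

module Submission where

-- A copy of S_k is determined by its centre c together with its k − 1 leaves, a subset of
-- the neighbourhood of c; so there are at most Σ_v C(d_v, k − 1) copies.  For exponent
-- r ≥ 3, C(2 + a, r) + C(2 + b, r) ≤ C(2 + a + b, r), so this sum is at most
-- C(2 + Σ_v (d_v − 2)⁺, k − 1).  In a tree every degree is at least 1 and Σ_v d_v = 2n − 2,
-- so 2 + Σ_v (d_v − 2)⁺ is at most the number of vertices of degree 1, which is at most n − x.

open import Defs renaming (sym to adj-sym)
open import Data.Nat using (ℕ; zero; suc; _+_; _*_; _∸_; _≤_; _≤′_; ≤′-refl; ≤′-step; z≤n; s≤s; s≤s⁻¹; _≤?_; _<?_)
open import Data.Nat.Properties
open import Data.Nat.Combinatorics using (_C_; nCk+nC[k+1]≡[n+1]C[k+1])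
open import Data.Fin using (Fin; zero; suc; toℕ; punchIn; inject₁; inject≤; fromℕ)
import Data.Fin.Properties as Finₚ
open Finₚ using (pigeonhole; inject≤-injective; any?) renaming (_≟_ to _≟ᶠ_)
open import Data.Fin.Subset using (Subset; inside; outside; _∈_; _∉_; _⊆_; ∣_∣; ⊥; ⁅_⁆; _─_; _-_; Empty)
open import Data.Fin.Subset.Properties
  using (⊆-antisym; drop-∷-⊆; x∈⁅x⁆; p─⊥≡p; p─q⊆p; x∈p∧x≢y⇒x∈p-y; Empty-unique; ∣⊥∣≡0)
open import Data.Bool using (Bool; true; false)
import Data.Bool.Properties as Bool
open import Data.Vec as Vec using (Vec; _∷_; []; uncons; here; there)
open import Data.Vec.Properties using (lookup⇒[]=; lookup∘tabulate)
open import Data.Vec.Relation.Binary.Pointwise.Extensional using (ext; Pointwise-≡⇒≡)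
open import Data.List as List using (List; []; _∷_; length; map; filter)
import Data.List.Properties as List
open import Data.List.Relation.Unary.All as All using (All; []; _∷_)
import Data.List.Relation.Unary.All.Properties as All
open import Data.List.Relation.Unary.AllPairs using ([]; _∷_)
open import Data.List.Relation.Unary.Unique.Propositional using (Unique)
import Data.List.Relation.Unary.Unique.Propositional.Properties as Unique
open import Data.Sum using (_⊎_; inj₁; inj₂)
open import Data.Product as Product using (_×_; _,_; proj₁; proj₂; ∃-syntax; uncurry)
open import Relation.Nullary using (¬?; yes; no; does; contradiction; _×-dec_)
open import Relation.Nullary.Decidable using (decidable-stable)
open import Relation.Unary using (Decidable)
open import Relation.Binary.Definitions using (DecidableEquality)
open import Relation.Binary.PropositionalEquality hiding ([_])
open import Function using (_∘_; id; case_of_)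
open import Function.Bundles using (_⇔_; mk⇔; Equivalence)
open import Function.Definitions using (Injective)
open import Algebra.Properties.CommutativeSemigroup +-commutativeSemigroup using (x∙yz≈y∙xz)
open import Algebra.Properties.CommutativeMonoid.Sum +-0-commutativeMonoid
  using (sum-syntax; sum-cong-≗; sum-remove; sum-replicate-zero; ∑-distrib-+)

-- Finite sums of natural numbers

𝟙 : Bool → ℕ
𝟙 true  = 1
𝟙 false = 0

∑-mono-≤ : ∀ {n} {f g : Fin n → ℕ} → (∀ i → f i ≤ g i) → ∑[ i < n ] f i ≤ ∑[ i < n ] g i
∑-mono-≤ {zero}  f≤g = z≤n
∑-mono-≤ {suc n} f≤g = +-mono-≤ (f≤g zero) (∑-mono-≤ (f≤g ∘ suc))

∑-const : ∀ n c → ∑[ i < n ] c ≡ n * c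
∑-const zero    c = refl
∑-const (suc n) c = cong (c +_) (∑-const n c)

term≤∑ : ∀ {n} (f : Fin (suc n) → ℕ) i → f i ≤ ∑[ j < suc n ] f j
term≤∑ f i = subst (f i ≤_) (sym (sum-remove {i = i} f)) (m≤m+n (f i) _)

∑𝟙-false : ∀ {n} (p : Fin n → Bool) → (∀ i → p i ≡ false) → ∑[ i < n ] 𝟙 (p i) ≡ 0
∑𝟙-false {n} p p≡false = trans (sum-cong-≗ (cong 𝟙 ∘ p≡false)) (sum-replicate-zero n)

∑𝟙≤1 : ∀ {n} (p : Fin n → Bool) → (∀ i j → p i ≡ true → p j ≡ true → i ≡ j) →
       ∑[ i < n ] 𝟙 (p i) ≤ 1
∑𝟙≤1 {zero}  p unique = z≤n
∑𝟙≤1 {suc n} p unique with p zero in p₀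
... | true  = ≤-reflexive (cong suc (∑𝟙-false (p ∘ suc) only-zero))
  where
  only-zero : ∀ i → p (suc i) ≡ false
  only-zero i with p (suc i) in pᵢ
  ... | true  = case unique zero (suc i) p₀ pᵢ of λ ()
  ... | false = refl
... | false = ∑𝟙≤1 (p ∘ suc) (λ i j pᵢ pⱼ → Finₚ.suc-injective (unique (suc i) (suc j) pᵢ pⱼ))

∑𝟙[≡]≡1 : ∀ {n} (c : Fin n) → ∑[ a < n ] 𝟙 (does (c ≟ᶠ a)) ≡ 1
∑𝟙[≡]≡1 {suc n} zero    = cong suc (∑𝟙-false {n} _ (λ _ → refl))
∑𝟙[≡]≡1 {suc n} (suc c) = ∑𝟙[≡]≡1 c

length-filter-tabulate : ∀ {n} {A : Set} {P : A → Set} (P? : Decidable P) (f : Fin n → A) →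
                         length (filter P? (List.tabulate f)) ≡ ∑[ i < n ] 𝟙 (does (P? (f i)))
length-filter-tabulate {zero}  P? f = refl
length-filter-tabulate {suc n} P? f with does (P? (f zero))
... | true  = cong suc (length-filter-tabulate P? (f ∘ suc))
... | false = length-filter-tabulate P? (f ∘ suc)

-- Duplicate-free lists

Unique-≡⇒length≤1 : ∀ {A : Set} {x : A} {xs} → Unique xs → All (_≡ x) xs → length xs ≤ 1
Unique-≡⇒length≤1 {xs = []}          _                 _                  = z≤n
Unique-≡⇒length≤1 {xs = _ ∷ []}      _                 _                  = s≤s z≤n
Unique-≡⇒length≤1 {xs = _ ∷ _ ∷ _} ((y≢z ∷ _) ∷ _) (refl ∷ refl ∷ _) = contradiction refl y≢z

module _ {A B : Set} (_≟_ : DecidableEquality A) where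

  fibre : A → List (A × B) → List B
  fibre a []              = []
  fibre a ((a′ , b) ∷ K) with a′ ≟ a
  ... | yes _ = b ∷ fibre a K
  ... | no  _ = fibre a K

  fibre-all : ∀ {P : A → B → Set} {K} a → All (uncurry P) K → All (P a) (fibre a K)
  fibre-all a [] = []
  fibre-all {K = (a′ , b) ∷ K} a (p ∷ ps) with a′ ≟ a
  ... | yes refl = p ∷ fibre-all a ps
  ... | no  _    = fibre-all a ps

  fibre-unique : ∀ {K} a → Unique K → Unique (fibre a K)
  fibre-unique a [] = []
  fibre-unique {(a′ , b) ∷ K} a (b∉K ∷ u) with a′ ≟ a
  ... | yes refl = All.map (λ ne → ne ∘ cong (a ,_)) (fibre-all a b∉K) ∷ fibre-unique a u
  ... | no  _    = fibre-unique a u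

  length-fibre-∷ : ∀ a a′ b K → length (fibre a ((a′ , b) ∷ K)) ≡ 𝟙 (does (a′ ≟ a)) + length (fibre a K)
  length-fibre-∷ a a′ b K with a′ ≟ a
  ... | yes _ = refl
  ... | no  _ = refl

length≡∑length-fibre : ∀ {n} {B : Set} (K : List (Fin n × B)) →
                       length K ≡ ∑[ a < n ] length (fibre _≟ᶠ_ a K)
length≡∑length-fibre {n} [] = sym (sum-replicate-zero n)
length≡∑length-fibre {n} ((c , b) ∷ K) = begin
  suc (length K)
    ≡⟨ cong₂ _+_ (∑𝟙[≡]≡1 c) (sym (length≡∑length-fibre K)) ⟨
  ∑[ a < n ] 𝟙 (does (c ≟ᶠ a)) + ∑[ a < n ] length (fibre _≟ᶠ_ a K)
    ≡⟨ ∑-distrib-+ {n} _ _ ⟨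
  ∑[ a < n ] (𝟙 (does (c ≟ᶠ a)) + length (fibre _≟ᶠ_ a K))
    ≡⟨ sum-cong-≗ (λ a → length-fibre-∷ _≟ᶠ_ a c b K) ⟨
  ∑[ a < n ] length (fibre _≟ᶠ_ a ((c , b) ∷ K))
    ∎
  where open ≡-Reasoning

length≡length-fibre-true+false : ∀ {B : Set} (K : List (Bool × B)) →
                                 length K ≡ length (fibre Bool._≟_ true K) + length (fibre Bool._≟_ false K)
length≡length-fibre-true+false []              = refl
length≡length-fibre-true+false ((true  , _) ∷ K) = cong suc (length≡length-fibre-true+false K)
length≡length-fibre-true+false ((false , _) ∷ K) =
  trans (cong suc (length≡length-fibre-true+false K)) (sym (+-suc _ _))

module _ {A B : Set} {P : A → Set} (f : ∀ x → P x → B) where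

  reduce : ∀ {xs} → All P xs → List B
  reduce = All.reduce (λ {x} → f x)

  length-reduce : ∀ {xs} (pxs : All P xs) → length (reduce pxs) ≡ length xs
  length-reduce []         = refl
  length-reduce (px ∷ pxs) = cong suc (length-reduce pxs)

  All-reduce⁺ : ∀ {Q : B → Set} {R : A → Set} → (∀ x (px : P x) → R x → Q (f x px)) →
                ∀ {xs} → All R xs → (pxs : All P xs) → All Q (reduce pxs)
  All-reduce⁺ g []         []         = []
  All-reduce⁺ g (rx ∷ rxs) (px ∷ pxs) = g _ px rx ∷ All-reduce⁺ g rxs pxs

  Unique-reduce⁺ : (∀ x y (px : P x) (py : P y) → f x px ≡ f y py → x ≡ y) →
                   ∀ {xs} → Unique xs → (pxs : All P xs) → Unique (reduce pxs)
  Unique-reduce⁺ f-inj []         []         = []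
  Unique-reduce⁺ f-inj (x∉xs ∷ u) (px ∷ pxs) =
    All-reduce⁺ (λ _ py x≢y fx≡fy → x≢y (f-inj _ _ px py fx≡fy)) x∉xs pxs ∷ Unique-reduce⁺ f-inj u pxs

-- Subsets

∣tabulate∣≡∑ : ∀ {n} (p : Fin n → Bool) → ∣ Vec.tabulate p ∣ ≡ ∑[ i < n ] 𝟙 (p i)
∣tabulate∣≡∑ {zero}  p = refl
∣tabulate∣≡∑ {suc n} p with p zero
... | true  = cong suc (∣tabulate∣≡∑ (p ∘ suc))
... | false = ∣tabulate∣≡∑ (p ∘ suc)

∣p∣≡0⇒p≡⊥ : ∀ {n} {p : Subset n} → ∣ p ∣ ≡ 0 → p ≡ ⊥
∣p∣≡0⇒p≡⊥ {p = []}          _ = refl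
∣p∣≡0⇒p≡⊥ {p = outside ∷ p} e = cong (outside ∷_) (∣p∣≡0⇒p≡⊥ e)

tailsWith : ∀ {n} → Bool → List (Vec Bool (suc n)) → List (Vec Bool n)
tailsWith b = fibre Bool._≟_ b ∘ map uncons

tailsWith-all : ∀ {n} {P : Vec Bool (suc n) → Set} {L} b → All P L → All (P ∘ (b ∷_)) (tailsWith b L)
tailsWith-all b = fibre-all Bool._≟_ b ∘ All.map⁺ ∘ All.map (λ { {_ ∷ _} p → p })

tailsWith-unique : ∀ {n} {L : List (Vec Bool (suc n))} b → Unique L → Unique (tailsWith b L)
tailsWith-unique b = fibre-unique Bool._≟_ b ∘ Unique.map⁺ uncons-injective
  where
  uncons-injective : ∀ {n} {xs ys : Vec Bool (suc n)} → uncons xs ≡ uncons ys → xs ≡ ys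
  uncons-injective {xs = _ ∷ _} {_ ∷ _} refl = refl

length≡length-tailsWith-true+false : ∀ {n} (L : List (Vec Bool (suc n))) →
  length L ≡ length (tailsWith true L) + length (tailsWith false L)
length≡length-tailsWith-true+false L =
  trans (sym (List.length-map uncons L)) (length≡length-fibre-true+false (map uncons L))

subsets-of-size≤ : ∀ {n} (P : Subset n) m {L : List (Subset n)} → Unique L →
                   All (λ S → S ⊆ P × ∣ S ∣ ≡ m) L → length L ≤ ∣ P ∣ C m
subsets-of-size≤ P zero u a = Unique-≡⇒length≤1 u (All.map (∣p∣≡0⇒p≡⊥ ∘ proj₂) a)
subsets-of-size≤ [] (suc m) {[]}    _ _              = z≤n
subsets-of-size≤ [] (suc m) {[] ∷ _} _ ((_ , ()) ∷ _)
subsets-of-size≤ {suc n} (outside ∷ P) (suc m) {L} u a = begin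
  length L                                   ≡⟨ length≡length-tailsWith-true+false L ⟩
  length (tailsWith true L) + length L₀      ≡⟨ cong (λ K → length K + length L₀) no-inside ⟩
  length L₀                                  ≤⟨ subsets-of-size≤ P (suc m) (tailsWith-unique false u)
                                                  (All.map (Product.map₁ drop-∷-⊆) (tailsWith-all false a)) ⟩
  ∣ P ∣ C suc m                              ∎
  where
  open ≤-Reasoning
  L₀ : List (Subset n)
  L₀ = tailsWith false L
  no-inside : tailsWith true L ≡ []
  no-inside with tailsWith true L | tailsWith-all true a
  ... | []    | []                = refl
  ... | _ ∷ _ | (S⊆P , _) ∷ _ with S⊆P here
  ...   | ()
subsets-of-size≤ (inside ∷ P) (suc m) {L} u a = begin
  length L                                   ≡⟨ length≡length-tailsWith-true+false L ⟩
  length (tailsWith true L) + length (tailsWith false L)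
    ≤⟨ +-mono-≤ (subsets-of-size≤ P m (tailsWith-unique true u)
                   (All.map (Product.map drop-∷-⊆ suc-injective) (tailsWith-all true a)))
                (subsets-of-size≤ P (suc m) (tailsWith-unique false u)
                   (All.map (Product.map₁ drop-∷-⊆) (tailsWith-all false a))) ⟩
  ∣ P ∣ C m + ∣ P ∣ C suc m                  ≡⟨ nCk+nC[k+1]≡[n+1]C[k+1] ∣ P ∣ m ⟩
  suc ∣ P ∣ C suc m                          ∎
  where open ≤-Reasoning

x∈p─q⇒x∉q : ∀ {n} (p q : Subset n) {x} → x ∈ p ─ q → x ∉ q
x∈p─q⇒x∉q (inside ∷ p) (outside ∷ q) here         ()
x∈p─q⇒x∉q (_ ∷ p)      (_ ∷ q)       (there x∈p─q) (there x∈q) = x∈p─q⇒x∉q p q x∈p─q x∈q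

x∈p-y⇒x≢y : ∀ {n} {p : Subset n} {x y} → x ∈ p - y → x ≢ y
x∈p-y⇒x≢y {p = p} {x} x∈p-x refl = x∈p─q⇒x∉q p ⁅ x ⁆ x∈p-x (x∈⁅x⁆ x)

∣p∣≡1+∣p-x∣ : ∀ {n} {p : Subset n} {x} → x ∈ p → ∣ p ∣ ≡ suc ∣ p - x ∣
∣p∣≡1+∣p-x∣ {p = inside  ∷ p} here        = cong (suc ∘ ∣_∣) (sym (p─⊥≡p p))
∣p∣≡1+∣p-x∣ {p = inside  ∷ p} (there x∈p) = cong suc (∣p∣≡1+∣p-x∣ x∈p)
∣p∣≡1+∣p-x∣ {p = outside ∷ p} (there x∈p) = ∣p∣≡1+∣p-x∣ x∈p

IsImage : ∀ {k n} → (Fin k → Fin n) → Subset n → Set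
IsImage σ p = ∀ v → v ∈ p ⇔ (∃[ a ] σ a ≡ v)

IsImage-remove : ∀ {k n} {σ : Fin (suc k) → Fin n} {p} → Injective _≡_ _≡_ σ →
                 IsImage σ p → IsImage (σ ∘ suc) (p - σ zero)
IsImage-remove {σ = σ} {p} σ-inj img v = mk⇔ to from
  where
  to : v ∈ p - σ zero → ∃[ a ] σ (suc a) ≡ v
  to v∈p-σ₀ with Equivalence.to (img v) (p─q⊆p p _ v∈p-σ₀)
  ... | zero  , refl = contradiction refl (x∈p-y⇒x≢y v∈p-σ₀)
  ... | suc a , σa≡v = a , σa≡v
  from : ∃[ a ] σ (suc a) ≡ v → v ∈ p - σ zero
  from (a , refl) = x∈p∧x≢y⇒x∈p-y (Equivalence.from (img _) (suc a , refl)) (λ e → case σ-inj e of λ ())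

∣image∣≡ : ∀ {k n} {σ : Fin k → Fin n} {p} → Injective _≡_ _≡_ σ → IsImage σ p → ∣ p ∣ ≡ k
∣image∣≡ {zero}  {n} _ img = trans (cong ∣_∣ (Empty-unique no-member)) (∣⊥∣≡0 n)
  where
  no-member : Empty _
  no-member (v , v∈p) with Equivalence.to (img v) v∈p
  ... | () , _
∣image∣≡ {suc k} {σ = σ} σ-inj img =
  trans (∣p∣≡1+∣p-x∣ (Equivalence.from (img (σ zero)) (zero , refl)))
        (cong suc (∣image∣≡ (Finₚ.suc-injective ∘ σ-inj) (IsImage-remove σ-inj img)))

-- Binomial coefficients

nCk≤[n+1]Ck : ∀ n k → n C k ≤ suc n C k
nCk≤[n+1]Ck n zero    = ≤-refl
nCk≤[n+1]Ck n (suc k) = subst (n C suc k ≤_) (nCk+nC[k+1]≡[n+1]C[k+1] n k) (m≤n+m _ _)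

C-monoˡ-≤ : ∀ r {m n} → m ≤ n → m C r ≤ n C r
C-monoˡ-≤ r = mono ∘ ≤⇒≤′
  where
  mono : ∀ {m n} → m ≤′ n → m C r ≤ n C r
  mono ≤′-refl        = ≤-refl
  mono (≤′-step m≤′n) = ≤-trans (mono m≤′n) (nCk≤[n+1]Ck _ r)

-- False for exponent 2 (a = b = 0 gives 2 ≤ 1): this is where k ≥ 4 is needed.
C-superadditive : ∀ r a b → (2 + a) C (3 + r) + (2 + b) C (3 + r) ≤ (2 + a + b) C (3 + r)
C-superadditive r a zero =
  subst (λ x → (2 + a) C (3 + r) + 0 ≤ x C (3 + r)) (sym (+-identityʳ (2 + a))) (≤-reflexive (+-identityʳ _))
C-superadditive r a (suc b) = begin
  X + (3 + b) C (3 + r)                             ≡⟨ cong (X +_) (nCk+nC[k+1]≡[n+1]C[k+1] (2 + b) (2 + r)) ⟨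
  X + ((2 + b) C (2 + r) + (2 + b) C (3 + r))       ≡⟨ x∙yz≈y∙xz X ((2 + b) C (2 + r)) ((2 + b) C (3 + r)) ⟩
  (2 + b) C (2 + r) + (X + (2 + b) C (3 + r))       ≤⟨ +-mono-≤ (C-monoˡ-≤ (2 + r) (s≤s (s≤s (m≤n+m b a))))
                                                                (C-superadditive r a b) ⟩
  (2 + a + b) C (2 + r) + (2 + a + b) C (3 + r)     ≡⟨ nCk+nC[k+1]≡[n+1]C[k+1] (2 + a + b) (2 + r) ⟩
  (3 + a + b) C (3 + r)                             ≡⟨ cong (_C (3 + r)) (+-suc (2 + a) b) ⟨
  (2 + a + suc b) C (3 + r)                         ∎
  where
  open ≤-Reasoning
  X : ℕ
  X = (2 + a) C (3 + r)

∑C≤C[2+∑excess] : ∀ r {n} (d : Fin n → ℕ) →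
                   ∑[ v < n ] (d v C (3 + r)) ≤ (2 + ∑[ v < n ] (d v ∸ 2)) C (3 + r)
∑C≤C[2+∑excess] r {zero}  d = z≤n
∑C≤C[2+∑excess] r {suc n} d with d zero | ∑C≤C[2+∑excess] r (d ∘ suc)
... | 0           | ih = ih
... | 1           | ih = ih
... | suc (suc e) | ih = ≤-trans (+-monoʳ-≤ ((2 + e) C (3 + r)) ih) (C-superadditive r e _)

-- Degrees

degree≡∑ : ∀ {n} (G : Graph n) v → degree G v ≡ ∑[ w < n ] 𝟙 (adj G v w)
degree≡∑ G v = trans (length-filter-tabulate (λ w → adj G v w Bool.≟ true) id)
                     (sum-cong-≗ (λ w → cong 𝟙 (does-≟-true (adj G v w))))
  where
  does-≟-true : ∀ b → does (b Bool.≟ true) ≡ b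
  does-≟-true true  = refl
  does-≟-true false = refl

numDegGe2≡∑ : ∀ {n} (G : Graph n) → numDegGe2 G ≡ ∑[ v < n ] 𝟙 (does (2 ≤? degree G v))
numDegGe2≡∑ G = length-filter-tabulate (λ v → 2 ≤? degree G v) id

neighbours : ∀ {n} → Graph n → Fin n → Subset n
neighbours G v = Vec.tabulate (adj G v)

∣neighbours∣≡degree : ∀ {n} (G : Graph n) v → ∣ neighbours G v ∣ ≡ degree G v
∣neighbours∣≡degree G v = trans (∣tabulate∣≡∑ (adj G v)) (sym (degree≡∑ G v))

degree-isolated : (G : Graph 1) → degree G zero ≡ 0
degree-isolated G = trans (degree≡∑ G zero) (cong (λ b → 𝟙 b + 0) (irrfl G zero))

walk⇒degree≥1 : ∀ {n} {G : Graph (suc n)} {u v} → Walk G u v → u ≢ v → 1 ≤ degree G u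
walk⇒degree≥1         here                   u≢u = contradiction refl u≢u
walk⇒degree≥1 {n} {G} {u} (step {w = w} u~w _) _ = begin
  1                               ≡⟨ cong 𝟙 u~w ⟨
  𝟙 (adj G u w)                   ≤⟨ term≤∑ (𝟙 ∘ adj G u) w ⟩
  ∑[ x < suc n ] 𝟙 (adj G u x)    ≡⟨ degree≡∑ G u ⟨
  degree G u                      ∎
  where open ≤-Reasoning

connected⇒degree≥1 : ∀ {n} (G : Graph (suc (suc n))) → Connected G → ∀ v → 1 ≤ degree G v
connected⇒degree≥1 G connected zero    = walk⇒degree≥1 (connected zero (suc zero)) (λ ())
connected⇒degree≥1 G connected (suc v) = walk⇒degree≥1 (connected (suc v) zero) (λ ())

-- Copies of a star

true⇔true⇒≡ : ∀ {a b : Bool} → (a ≡ true → b ≡ true) → (b ≡ true → a ≡ true) → a ≡ b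
true⇔true⇒≡ {true}          a⇒b _   = sym (a⇒b refl)
true⇔true⇒≡ {false} {true}  _   b⇒a = b⇒a refl
true⇔true⇒≡ {false} {false} _   _   = refl

record IsStar {n} (c : Fin n) (S : Subset n) (H : Subgraph n) : Set where
  field
    verts⇔ : ∀ v → v ∈ verts H ⇔ (v ≡ c ⊎ v ∈ S)
    edges⇔ : ∀ i j → E H i j ≡ true ⇔ ((i ≡ c × j ∈ S) ⊎ (i ∈ S × j ≡ c))

IsStar-unique : ∀ {n c S} {H H′ : Subgraph n} → IsStar c S H → IsStar c S H′ → H ≡ H′
IsStar-unique {H = sg V Es} {sg V′ Es′} s s′ = cong₂ sg (⊆-antisym (V⊆ s s′) (V⊆ s′ s)) (matrix-ext E≡)
  where
  open IsStar
  V⊆ : ∀ {H H′} → IsStar _ _ H → IsStar _ _ H′ → verts H ⊆ verts H′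
  V⊆ s s′ {v} = Equivalence.from (verts⇔ s′ v) ∘ Equivalence.to (verts⇔ s v)
  E≡ : ∀ i j → E (sg V Es) i j ≡ E (sg V′ Es′) i j
  E≡ i j = true⇔true⇒≡ (Equivalence.from (edges⇔ s′ i j) ∘ Equivalence.to (edges⇔ s i j))
                       (Equivalence.from (edges⇔ s i j) ∘ Equivalence.to (edges⇔ s′ i j))
  matrix-ext : (∀ i j → Vec.lookup (Vec.lookup Es i) j ≡ Vec.lookup (Vec.lookup Es′ i) j) → Es ≡ Es′
  matrix-ext e = Pointwise-≡⇒≡ (ext λ i → Pointwise-≡⇒≡ (ext (e i)))

module StarCopyOf {n} (G : Graph n) {r} (H : Subgraph n) (sc : StarCopy G (suc r) H) where
  private
    σ : Fin (suc r) → Fin n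
    σ = proj₁ (proj₂ sc)
    σ-inj : Injective _≡_ _≡_ σ
    σ-inj = proj₁ (proj₂ (proj₂ sc))
    V-img : IsImage σ (verts H)
    V-img = proj₁ (proj₂ (proj₂ (proj₂ sc)))
    E⇔star : ∀ a b → E H (σ a) (σ b) ≡ true ⇔ StarAdj a b
    E⇔star = proj₂ (proj₂ (proj₂ (proj₂ sc)))

  centre : Fin n
  centre = σ zero

  leaves : Subset n
  leaves = verts H - centre

  leaves-image : IsImage (σ ∘ suc) leaves
  leaves-image = IsImage-remove σ-inj V-img

  ∣leaves∣≡ : ∣ leaves ∣ ≡ r
  ∣leaves∣≡ = ∣image∣≡ (Finₚ.suc-injective ∘ σ-inj) leaves-image

  private
    leaf : ∀ a → σ (suc a) ∈ leaves
    leaf a = Equivalence.from (leaves-image _) (a , refl)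

    spoke : ∀ a → E H centre (σ (suc a)) ≡ true
    spoke a = Equivalence.from (E⇔star zero (suc a)) (inj₁ (refl , λ ()))

  leaves⊆neighbours : leaves ⊆ neighbours G centre
  leaves⊆neighbours {v} v∈leaves with Equivalence.to (leaves-image v) v∈leaves
  ... | a , refl = lookup⇒[]= v _ (trans (lookup∘tabulate _ v) (proj₂ (proj₂ (proj₁ sc _ _ (spoke a)))))

  isStar : IsStar centre leaves H
  isStar = record { verts⇔ = λ v → mk⇔ (V-to v) V-from ; edges⇔ = λ i j → mk⇔ (E-to i j) E-from }
    where
    V-to : ∀ v → v ∈ verts H → v ≡ centre ⊎ v ∈ leaves
    V-to v v∈V with v ≟ᶠ centre
    ... | yes v≡c = inj₁ v≡c
    ... | no  v≢c = inj₂ (x∈p∧x≢y⇒x∈p-y v∈V v≢c)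
    V-from : ∀ {v} → v ≡ centre ⊎ v ∈ leaves → v ∈ verts H
    V-from (inj₁ refl)     = Equivalence.from (V-img _) (zero , refl)
    V-from (inj₂ v∈leaves) = p─q⊆p _ _ v∈leaves
    star→ : ∀ a b → StarAdj a b → (σ a ≡ centre × σ b ∈ leaves) ⊎ (σ a ∈ leaves × σ b ≡ centre)
    star→ zero    zero    (inj₁ (_ , 0≢0)) = contradiction refl 0≢0
    star→ zero    zero    (inj₂ (0≢0 , _)) = contradiction refl 0≢0
    star→ zero    (suc b) _                = inj₁ (refl , leaf b)
    star→ (suc a) zero    _                = inj₂ (leaf a , refl)
    star→ (suc a) (suc b) (inj₁ (() , _))
    star→ (suc a) (suc b) (inj₂ (_ , ()))
    E-to : ∀ i j → E H i j ≡ true → (i ≡ centre × j ∈ leaves) ⊎ (i ∈ leaves × j ≡ centre)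
    E-to i j e with proj₁ sc i j e
    ... | i∈V , j∈V , _ with Equivalence.to (V-img i) i∈V | Equivalence.to (V-img j) j∈V
    ...   | a , refl | b , refl = star→ a b (Equivalence.to (E⇔star a b) e)
    E-from : ∀ {i j} → (i ≡ centre × j ∈ leaves) ⊎ (i ∈ leaves × j ≡ centre) → E H i j ≡ true
    E-from (inj₁ (refl , j∈leaves)) with Equivalence.to (leaves-image _) j∈leaves
    ... | b , refl = spoke b
    E-from (inj₂ (i∈leaves , refl)) with Equivalence.to (leaves-image _) i∈leaves
    ... | a , refl = Equivalence.from (E⇔star (suc a) zero) (inj₂ ((λ ()) , refl))

starKey : ∀ {n r} (G : Graph n) H → StarCopy G (suc r) H → Fin n × Subset n
starKey G H sc = centre , leaves
  where open StarCopyOf G H sc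

starKey-injective : ∀ {n r} (G : Graph n) H H′ (sc : StarCopy G (suc r) H) (sc′ : StarCopy G (suc r) H′) →
                    starKey G H sc ≡ starKey G H′ sc′ → H ≡ H′
starKey-injective G H H′ sc sc′ key≡ =
  IsStar-unique (StarCopyOf.isStar G H sc)
                (subst (λ (c , S) → IsStar c S H′) (sym key≡) (StarCopyOf.isStar G H′ sc′))

starCopies≤∑C : ∀ {n r} (G : Graph n) {L} → Unique L → All (StarCopy G (suc r)) L →
                length L ≤ ∑[ c < n ] (degree G c C r)
starCopies≤∑C {n} {r} G {L} u a = begin
  length L                               ≡⟨ length-reduce (starKey G) a ⟨
  length K                               ≡⟨ length≡∑length-fibre K ⟩
  ∑[ c < n ] length (fibre _≟ᶠ_ c K)     ≤⟨ ∑-mono-≤ (λ c → subsets-of-size≤ (neighbours G c) r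
                                                       (fibre-unique _≟ᶠ_ c K-unique) (fibre-all _≟ᶠ_ c K-all)) ⟩
  ∑[ c < n ] (∣ neighbours G c ∣ C r)    ≡⟨ sum-cong-≗ (λ c → cong (_C r) (∣neighbours∣≡degree G c)) ⟩
  ∑[ c < n ] (degree G c C r)            ∎
  where
  open ≤-Reasoning
  K : List (Fin n × Subset n)
  K = reduce (starKey G) a
  K-unique : Unique K
  K-unique = Unique-reduce⁺ (starKey G) (starKey-injective G) u a
  K-all : All (uncurry λ c S → S ⊆ neighbours G c × ∣ S ∣ ≡ r) K
  K-all = All-reduce⁺ (starKey G) (λ H sc _ → let open StarCopyOf G H sc
                                               in (λ {v} → leaves⊆neighbours {v}) , ∣leaves∣≡) a a

-- Forests and trees

removeVertex : ∀ {n} → Graph (suc n) → Fin (suc n) → Graph n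
removeVertex G u = record
  { adj   = λ i j → adj G (punchIn u i) (punchIn u j)
  ; sym   = λ i j → adj-sym G (punchIn u i) (punchIn u j)
  ; irrfl = λ i → irrfl G (punchIn u i)
  }

removeVertex-acyclic : ∀ {n} (G : Graph (suc n)) u → Acyclic G → Acyclic (removeVertex G u)
removeVertex-acyclic G u acyclic c = acyclic record
  { m    = Cycle.m c
  ; f    = punchIn u ∘ Cycle.f c
  ; inj  = Cycle.inj c ∘ Finₚ.punchIn-injective u _ _
  ; cons = Cycle.cons c
  ; wrap = Cycle.wrap c
  }

∑degree-removeVertex : ∀ {n} (G : Graph (suc n)) u →
  ∑[ v < suc n ] degree G v ≡ degree G u + (degree G u + ∑[ v < n ] degree (removeVertex G u) v)
∑degree-removeVertex {n} G u = begin
  ∑[ v < suc n ] degree G v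
    ≡⟨ sum-remove {i = u} (degree G) ⟩
  degree G u + ∑[ i < n ] degree G (punchIn u i)
    ≡⟨ cong (degree G u +_) (sum-cong-≗ degree-punchIn) ⟩
  degree G u + ∑[ i < n ] (𝟙 (adj G u (punchIn u i)) + degree G-u i)
    ≡⟨ cong (degree G u +_) (∑-distrib-+ {n} (𝟙 ∘ adj G u ∘ punchIn u) (degree G-u)) ⟩
  degree G u + (∑[ i < n ] 𝟙 (adj G u (punchIn u i)) + ∑[ v < n ] degree G-u v)
    ≡⟨ cong (λ d → degree G u + (d + ∑[ v < n ] degree G-u v)) (sym degree-at-u) ⟩
  degree G u + (degree G u + ∑[ v < n ] degree G-u v)
    ∎
  where
  open ≡-Reasoning
  G-u : Graph n
  G-u = removeVertex G u
  degree-at-u : degree G u ≡ ∑[ i < n ] 𝟙 (adj G u (punchIn u i))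
  degree-at-u = trans (degree≡∑ G u) (trans (sum-remove {i = u} (𝟙 ∘ adj G u))
                  (cong (λ b → 𝟙 b + ∑[ i < n ] 𝟙 (adj G u (punchIn u i))) (irrfl G u)))
  degree-punchIn : ∀ i → degree G (punchIn u i) ≡ 𝟙 (adj G u (punchIn u i)) + degree G-u i
  degree-punchIn i = begin
    degree G (punchIn u i)
      ≡⟨ degree≡∑ G _ ⟩
    ∑[ w < suc n ] 𝟙 (adj G (punchIn u i) w)
      ≡⟨ sum-remove {i = u} (𝟙 ∘ adj G (punchIn u i)) ⟩
    𝟙 (adj G (punchIn u i) u) + ∑[ j < n ] 𝟙 (adj G-u i j)
      ≡⟨ cong₂ _+_ (cong 𝟙 (adj-sym G _ u)) (sym (degree≡∑ G-u i)) ⟩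
    𝟙 (adj G u (punchIn u i)) + degree G-u i
      ∎

record Path {N} (G : Graph N) (j : ℕ) : Set where
  field
    vertex    : Fin (suc j) → Fin N
    injective : Injective _≡_ _≡_ vertex
    adjacent  : ∀ (i : Fin j) → adj G (vertex (inject₁ i)) (vertex (suc i)) ≡ true

  start : Fin N
  start = vertex zero

inject≤-inject₁ : ∀ {m n} (i : Fin m) .(le : suc m ≤ suc n) →
                  inject≤ (inject₁ i) le ≡ inject₁ (inject≤ i (s≤s⁻¹ le))
inject≤-inject₁ i le = Finₚ.toℕ-injective (begin
  toℕ (inject≤ (inject₁ i) le)          ≡⟨ Finₚ.toℕ-inject≤ _ le ⟩
  toℕ (inject₁ i)                       ≡⟨ Finₚ.toℕ-inject₁ i ⟩
  toℕ i                                 ≡⟨ Finₚ.toℕ-inject≤ i _ ⟨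
  toℕ (inject≤ i _)                     ≡⟨ Finₚ.toℕ-inject₁ _ ⟨
  toℕ (inject₁ (inject≤ i (s≤s⁻¹ le)))  ∎)
  where open ≡-Reasoning

module _ {N} {G : Graph N} where
  open Path

  singleton : Fin N → Path G 0
  singleton v = record { vertex = λ _ → v ; injective = λ { {zero} {zero} _ → refl } ; adjacent = λ () }

  Path-size : ∀ {j} → Path G j → suc j ≤ N
  Path-size p = ≮⇒≥ λ N<1+j → let (i , i′ , i<i′ , pᵢ≡pᵢ′) = pigeonhole N<1+j (vertex p)
                               in Finₚ.<-irrefl (injective p pᵢ≡pᵢ′) i<i′

  prepend : ∀ {j} (p : Path G j) w → adj G w (start p) ≡ true → (∀ t → vertex p t ≢ w) → Path G (suc j)
  prepend {j} p w w~p₀ w∉p = record { vertex = vertex′ ; injective = injective′ ; adjacent = adjacent′ }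
    where
    vertex′ : Fin (suc (suc j)) → Fin N
    vertex′ zero    = w
    vertex′ (suc t) = vertex p t
    injective′ : Injective _≡_ _≡_ vertex′
    injective′ {zero}  {zero}   _ = refl
    injective′ {zero}  {suc t}  e = contradiction (sym e) (w∉p t)
    injective′ {suc t} {zero}   e = contradiction e (w∉p t)
    injective′ {suc t} {suc t′} e = cong suc (injective p e)
    adjacent′ : ∀ (i : Fin (suc j)) → adj G (vertex′ (inject₁ i)) (vertex′ (suc i)) ≡ true
    adjacent′ zero    = w~p₀
    adjacent′ (suc i) = adjacent p i

  chord⇒cycle : ∀ {j} (p : Path G j) t → 2 ≤ toℕ t → adj G (start p) (vertex p t) ≡ true → Cycle G
  chord⇒cycle {j} p t 2≤t p₀~pₜ = record
    { m    = m
    ; f    = vertex p ∘ prefix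
    ; inj  = inject≤-injective le le _ _ ∘ injective p
    ; cons = λ i → subst (λ x → adj G (vertex p x) (vertex p (prefix (suc i))) ≡ true)
                         (sym (inject≤-inject₁ i le)) (adjacent p (inject≤ i (s≤s⁻¹ le)))
    ; wrap = subst (λ x → adj G (vertex p x) (start p) ≡ true) (sym prefix-last≡t)
                   (trans (adj-sym G (vertex p t) _) p₀~pₜ)
    }
    where
    m : ℕ
    m = toℕ t ∸ 2
    2+m≡t : 2 + m ≡ toℕ t
    2+m≡t = m+[n∸m]≡n 2≤t
    le : 3 + m ≤ suc j
    le = subst (λ x → suc x ≤ suc j) (sym 2+m≡t) (Finₚ.toℕ<n t)
    prefix : Fin (3 + m) → Fin (suc j)
    prefix i = inject≤ i le
    prefix-last≡t : prefix (fromℕ (2 + m)) ≡ t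
    prefix-last≡t = Finₚ.toℕ-injective (trans (Finₚ.toℕ-inject≤ _ le) (trans (Finₚ.toℕ-fromℕ _) 2+m≡t))

  endpoint-degree≤1 : ∀ {j} (p : Path G j) →
                      (∀ w → adj G (start p) w ≡ true → ∃[ t ] vertex p t ≡ w) →
                      (∀ t → 2 ≤ toℕ t → adj G (start p) (vertex p t) ≢ true) →
                      degree G (start p) ≤ 1
  endpoint-degree≤1 p on-path no-chord =
    subst (_≤ 1) (sym (degree≡∑ G _)) (∑𝟙≤1 (adj G (start p)) at-most-one)
    where
    second : ∀ w → adj G (start p) w ≡ true → ∃[ t ] vertex p t ≡ w × toℕ t ≡ 1
    second w p₀~w with on-path w p₀~w
    ... | zero        , refl = contradiction (trans (sym (irrfl G _)) p₀~w) (λ ())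
    ... | suc zero    , refl = suc zero , refl , refl
    ... | suc (suc t) , refl = contradiction p₀~w (no-chord (suc (suc t)) (s≤s (s≤s z≤n)))
    at-most-one : ∀ w w′ → adj G (start p) w ≡ true → adj G (start p) w′ ≡ true → w ≡ w′
    at-most-one w w′ p₀~w p₀~w′ with second w p₀~w | second w′ p₀~w′
    ... | t , refl , t≡1 | t′ , refl , t′≡1 = cong (vertex p) (Finₚ.toℕ-injective (trans t≡1 (sym t′≡1)))

  -- Grow a path at its start until the start vertex has no new neighbour; acyclicity then
  -- leaves the second path vertex as its only neighbour.  The fuel bounds the number of extensions.
  ∃leaf-from : Acyclic G → ∀ fuel {j} (p : Path G j) → N ≤ j + fuel → ∃[ u ] degree G u ≤ 1
  ∃leaf-from acyclic zero {j} p N≤j+0 =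
    contradiction (≤-trans (Path-size p) N≤j+0) (<-irrefl (sym (+-identityʳ j)))
  ∃leaf-from acyclic (suc fuel) {j} p N≤j+1+fuel
    with any? (λ t → (2 ≤? toℕ t) ×-dec (adj G (start p) (vertex p t) Bool.≟ true))
  ... | yes (t , 2≤t , p₀~pₜ) = contradiction (chord⇒cycle p t 2≤t p₀~pₜ) acyclic
  ... | no no-chord with any? (λ w → (adj G (start p) w Bool.≟ true) ×-dec ¬? (any? λ t → vertex p t ≟ᶠ w))
  ...   | yes (w , p₀~w , w∉p) = ∃leaf-from acyclic fuel p′ (subst (N ≤_) (+-suc j fuel) N≤j+1+fuel)
    where
    p′ : Path G (suc j)
    p′ = prepend p w (trans (adj-sym G w (start p)) p₀~w) (λ t pₜ≡w → w∉p (t , pₜ≡w))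
  ...   | no closed = start p , endpoint-degree≤1 p on-path (λ t 2≤t p₀~pₜ → no-chord (t , 2≤t , p₀~pₜ))
    where
    on-path : ∀ w → adj G (start p) w ≡ true → ∃[ t ] vertex p t ≡ w
    on-path w p₀~w = decidable-stable (any? λ t → vertex p t ≟ᶠ w) (λ w∉p → closed (w , p₀~w , w∉p))

acyclic⇒∃leaf : ∀ {n} (G : Graph (suc n)) → Acyclic G → ∃[ u ] degree G u ≤ 1
acyclic⇒∃leaf {n} G acyclic = ∃leaf-from acyclic (suc n) (singleton zero) ≤-refl

acyclic⇒∑degree≤ : ∀ n (G : Graph (suc n)) → Acyclic G → ∑[ v < suc n ] degree G v ≤ n * 2
acyclic⇒∑degree≤ zero    G _ = ≤-reflexive (cong (_+ 0) (degree-isolated G))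
acyclic⇒∑degree≤ (suc n) G acyclic with acyclic⇒∃leaf G acyclic
... | u , deg-u≤1 = begin
  ∑[ v < 2 + n ] degree G v                                     ≡⟨ ∑degree-removeVertex G u ⟩
  degree G u + (degree G u + ∑[ v < suc n ] degree G-u v)       ≤⟨ +-mono-≤ deg-u≤1 (+-mono-≤ deg-u≤1 ∑deg-G-u≤) ⟩
  suc n * 2                                                     ∎
  where
  open ≤-Reasoning
  G-u : Graph (suc n)
  G-u = removeVertex G u
  ∑deg-G-u≤ : ∑[ v < suc n ] degree G-u v ≤ n * 2
  ∑deg-G-u≤ = acyclic⇒∑degree≤ n G-u (removeVertex-acyclic G u acyclic)

excess+2≡degree+𝟙[<2] : ∀ d → 1 ≤ d → (d ∸ 2) + 2 ≡ d + 𝟙 (does (d <? 2))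
excess+2≡degree+𝟙[<2] (suc zero)    _ = refl
excess+2≡degree+𝟙[<2] (suc (suc e)) _ = trans (+-comm e 2) (sym (+-identityʳ (2 + e)))

𝟙[<2]+𝟙[2≤]≡1 : ∀ d → 𝟙 (does (d <? 2)) + 𝟙 (does (2 ≤? d)) ≡ 1
𝟙[<2]+𝟙[2≤]≡1 zero          = refl
𝟙[<2]+𝟙[2≤]≡1 (suc zero)    = refl
𝟙[<2]+𝟙[2≤]≡1 (suc (suc d)) = refl

tree-2+∑excess≤#[degree<2] : ∀ {n} (T : Graph (suc (suc n))) → IsTree T →
  2 + ∑[ v < 2 + n ] (degree T v ∸ 2) ≤ ∑[ v < 2 + n ] 𝟙 (does (degree T v <? 2))
tree-2+∑excess≤#[degree<2] {n} T (_ , connected , acyclic) = +-cancelʳ-≤ (suc n * 2) (2 + excess) ℓ (begin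
  (2 + excess) + suc n * 2                     ≡⟨ cong (_+ suc n * 2) (+-comm 2 excess) ⟩
  (excess + 2) + suc n * 2                     ≡⟨ +-assoc excess 2 _ ⟩
  excess + (2 + n) * 2                         ≡⟨ cong (excess +_) (∑-const (2 + n) 2) ⟨
  excess + ∑[ v < 2 + n ] 2                    ≡⟨ ∑-distrib-+ {2 + n} (λ v → d v ∸ 2) (λ _ → 2) ⟨
  ∑[ v < 2 + n ] ((d v ∸ 2) + 2)               ≡⟨ sum-cong-≗ (λ v → excess+2≡degree+𝟙[<2] (d v) (d≥1 v)) ⟩
  ∑[ v < 2 + n ] (d v + 𝟙 (does (d v <? 2)))   ≡⟨ ∑-distrib-+ {2 + n} d (λ v → 𝟙 (does (d v <? 2))) ⟩
  ∑[ v < 2 + n ] d v + ℓ                       ≤⟨ +-monoˡ-≤ ℓ (acyclic⇒∑degree≤ (suc n) T acyclic) ⟩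
  suc n * 2 + ℓ                                ≡⟨ +-comm (suc n * 2) ℓ ⟩
  ℓ + suc n * 2                                ∎)
  where
  open ≤-Reasoning
  d : Fin (2 + n) → ℕ
  d = degree T
  d≥1 : ∀ v → 1 ≤ d v
  d≥1 = connected⇒degree≥1 T connected
  excess ℓ : ℕ
  excess = ∑[ v < 2 + n ] (d v ∸ 2)
  ℓ = ∑[ v < 2 + n ] 𝟙 (does (d v <? 2))

#[degree<2]≤n∸x : ∀ {n x} (G : Graph n) → x ≤ numDegGe2 G → ∑[ v < n ] 𝟙 (does (degree G v <? 2)) ≤ n ∸ x
#[degree<2]≤n∸x {n} {x} G x≤#[2≤degree] = begin
  ℓ                 ≡⟨ m+n∸n≡m ℓ h ⟨
  ℓ + h ∸ h         ≡⟨ cong (_∸ h) ℓ+h≡n ⟩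
  n ∸ h             ≤⟨ ∸-monoʳ-≤ n (subst (x ≤_) (numDegGe2≡∑ G) x≤#[2≤degree]) ⟩
  n ∸ x             ∎
  where
  open ≤-Reasoning
  ℓ h : ℕ
  ℓ = ∑[ v < n ] 𝟙 (does (degree G v <? 2))
  h = ∑[ v < n ] 𝟙 (does (2 ≤? degree G v))
  ℓ+h≡n : ℓ + h ≡ n
  ℓ+h≡n = trans (sym (∑-distrib-+ {n} _ _))
                (trans (sum-cong-≗ (𝟙[<2]+𝟙[2≤]≡1 ∘ degree G)) (trans (∑-const n 1) (*-identityʳ n)))

tree-∑C≤ : ∀ r {n x} (T : Graph n) → IsTree T → x ≤ numDegGe2 T →
           ∑[ v < n ] (degree T v C (3 + r)) ≤ (n ∸ x) C (3 + r)
tree-∑C≤ r {0}           T (() , _)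
tree-∑C≤ r {1}           T _    _ = subst (λ d → d C (3 + r) + 0 ≤ _) (sym (degree-isolated T)) z≤n
tree-∑C≤ r {suc (suc n)} {x} T tree x≤#[2≤degree] = begin
  ∑[ v < 2 + n ] (degree T v C (3 + r))                        ≤⟨ ∑C≤C[2+∑excess] r (degree T) ⟩
  (2 + ∑[ v < 2 + n ] (degree T v ∸ 2)) C (3 + r)               ≤⟨ C-monoˡ-≤ (3 + r) (≤-trans
                                                                     (tree-2+∑excess≤#[degree<2] T tree)
                                                                     (#[degree<2]≤n∸x T x≤#[2≤degree])) ⟩
  (2 + n ∸ x) C (3 + r)                                         ∎
  where open ≤-Reasoning

lemma4p2 : (k n x : ℕ) → 4 ≤ k → (T : Graph n) → IsTree T → x ≤ numDegGe2 T →
           (L : List (Subgraph n)) → Unique L → All (StarCopy T k) L →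
           length L ≤ (n ∸ x) C (k ∸ 1)
lemma4p2 (suc (suc (suc (suc r)))) n x (s≤s (s≤s (s≤s (s≤s _)))) T tree x≤#[2≤degree] L unique stars =
  ≤-trans (starCopies≤∑C T unique stars) (tree-∑C≤ r T tree x≤#[2≤degree])
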